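{- Let $\mathbf{R}=(\mathbf{R}^{\Rightarrow},\mathbf{R}^{\mathrm{o}})$ with $\mathbf{R}^{\Rightarrow}=\emptyset$, let $M=(W,\succeq_N,\succeq_I,v)$ be an $\mathbf{R}$-ordered model, $w\in W$, and $A,B$ Boolean formulas. Then $M,w\models\bigcirc(B/A)$ iff there exists $v'\in W$ with $v'\models A\wedge B$ such that for all $u\in W$, if $u\succeq_I v'$ then $u\models A\rightarrow B$.
   Context: Formulas: Boolean formulas; obligations $\bigcirc(B/A)$ with $A,B$ Boolean (body $b=A$, head $h=B$). $\mathbf{R}^{\mathrm{o}}$ is a finite set of obligations. Override: relative to a fixed set $\Gamma$ of alethic formulas ($\Box$ over Boolean formulas), for $r_i,r_j\in\mathbf{R}^{\mathrm{o}}$, $r_j\triangleright r_i$ iff (i) $\{h(r_i),h(r_j)\}\cup\Gamma\models_{\mathrm{S5}}\bot$, (ii) $b(r_j)\models_{\mathrm{PL}}b(r_i)$ and $b(r_i)\not\models_{\mathrm{PL}}b(r_j)$, (iii) $h(r_i)\wedge b(r_j)\not\models_{\mathrm{PL}}\bot$. Violation set: $V(w)=\{r_i\in\mathbf{R}^{\mathrm{o}}: w\models b(r_i)\wedge\neg h(r_i)$ and $w\not\models b(r_j)$ for all $r_j\in\mathbf{R}^{\mathrm{o}}$ with $r_j\triangleright r_i\}$; ideality: $w_1\succeq_I w_2$ iff $V(w_1)\subseteq V(w_2)$. With $\mathbf{R}^{\Rightarrow}=\emptyset$ the normality ordering of an $\mathbf{R}$-ordered model is $\succeq_N=W\times W$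 (all worlds equally normal). An $\mathbf{R}$-ordered model $M=(W,\succeq_N,\succeq_I,v)$ has nonempty $W$, valuation $v$, and these orderings. $\max_{\succeq}(X)=\{w\in X:\forall u\in X(u\succeq w\Rightarrow w\succeq u)\}$; $\Vert A\Vert$ is the truth set of $A$. Lifting: $U\succeq_I^{s}U'$ iff for every $u'\in U'$ there is $u\in U$ with $u\succeq_I u'$. Truth: $M,w\models\bigcirc(B/A)$ iff $\max_{\succeq_N}(\Vert A\wedge\neg B\Vert)\not\succeq_I^{s}\max_{\succeq_N}(\Vert A\wedge B\Vert)$. -}

module Defs where

open import Level using (0ℓ) renaming (suc to lsuc)
open import Data.Nat using (ℕ)
open import Data.Bool using (Bool; true; false; not; _∧_; _∨_)
open import Data.List using (List; []; _∷_)
open import Data.List.Membership.Propositional using (_∈_)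
open import Data.List.Relation.Unary.All using (All)
open import Data.Product using (Σ; _×_; _,_)
open import Data.Unit using (⊤)
open import Relation.Nullary using (¬_)
open import Relation.Binary.PropositionalEquality using (_≡_)
open import Relation.Binary.Structures using (IsEquivalence)

infixr 6 _∧ᶠ_
infixr 5 _∨ᶠ_
infixr 4 _⇒ᶠ_

data Fm : Set where
  atom      : ℕ → Fm
  ⊤ᶠ ⊥ᶠ     : Fm
  ¬ᶠ_       : Fm → Fm
  _∧ᶠ_ _∨ᶠ_ _⇒ᶠ_ : Fm → Fm → Fm

Valuation : Set
Valuation = ℕ → Bool

eval : Valuation → Fm → Bool
eval ρ (atom p) = ρ p
eval ρ ⊤ᶠ = true
eval ρ ⊥ᶠ = false
eval ρ (¬ᶠ A) = not (eval ρ A)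
eval ρ (A ∧ᶠ B) = eval ρ A ∧ eval ρ B
eval ρ (A ∨ᶠ B) = eval ρ A ∨ eval ρ B
eval ρ (A ⇒ᶠ B) = not (eval ρ A) ∨ eval ρ B

_⊨_ : Valuation → Fm → Set
ρ ⊨ A = eval ρ A ≡ true

_⊨PL_ : Fm → Fm → Set
A ⊨PL B = ∀ (ρ : Valuation) → ρ ⊨ A → ρ ⊨ B

-- S5 entailment for  Δ ∪ {□C | C ∈ Γ} ⊨_S5 ⊥
-- (Δ : Boolean formulas, Γ : the Boolean formulas under the boxes)

record S5Model : Set₁ where
  field
    Wd    : Set
    R     : Wd → Wd → Set
    isEq  : IsEquivalence R
    val   : Wd → Valuation

S5Sat : (Γ : List Fm) → (Δ : List Fm) → Set₁
S5Sat Γ Δ = Σ S5Model λ K → let open S5Model K in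
  Σ Wd λ x → All (λ A → val x ⊨ A) Δ
           × All (λ C → ∀ y → R x y → val y ⊨ C) Γ

S5Inconsistent : (Γ : List Fm) → (Δ : List Fm) → Set₁
S5Inconsistent Γ Δ = ¬ S5Sat Γ Δ

-- Obligations ○(B/A): body b = A, head h = B

record Obligation : Set where
  constructor ○[_/_]
  field
    head : Fm
    body : Fm
open Obligation public

-- R-ordered models with R⇒ = ∅ : W nonempty, valuation v

record OrderedModel : Set₁ where
  field
    W        : Set
    nonempty : W
    v        : W → Valuation

module Semantics (Γ : List Fm) (Ro : List Obligation) (M : OrderedModel) where
  open OrderedModel M

  _▷_ : Obligation → Obligation → Set₁
  rj ▷ ri = S5Inconsistent Γ (head ri ∷ head rj ∷ [])
          × (body rj ⊨PL body ri)
          × ¬ (body ri ⊨PL body rj)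
          × ¬ ((head ri ∧ᶠ body rj) ⊨PL ⊥ᶠ)

  V : W → Obligation → Set₁
  V w ri = (ri ∈ Ro)
         × (v w ⊨ (body ri ∧ᶠ ¬ᶠ head ri))
         × (∀ rj → rj ∈ Ro → rj ▷ ri → ¬ (v w ⊨ body rj))

  _⪰I_ : W → W → Set₁
  w₁ ⪰I w₂ = ∀ r → V w₁ r → V w₂ r

  -- normality ordering (R⇒ = ∅): all worlds equally normal
  _⪰N_ : W → W → Set
  _ ⪰N _ = ⊤

  ‖_‖ : Fm → W → Set
  ‖ A ‖ w = v w ⊨ A

  max : ∀ {ℓ} → (W → W → Set ℓ) → (W → Set) → W → Set ℓ
  max _⪰_ X w = X w × (∀ u → X u → u ⪰ w → w ⪰ u)

  lift : ∀ {ℓ₁ ℓ₂} → (W → W → Set ℓ₁) → (W → Set ℓ₂) → (W → Set ℓ₂) → Set _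
  lift _⪰_ U U' = ∀ u' → U' u' → Σ W λ u → U u × (u ⪰ u')

  _⊨○[_/_] : W → Fm → Fm → Set₁
  w ⊨○[ B / A ] = ¬ lift _⪰I_ (max _⪰N_ ‖ A ∧ᶠ ¬ᶠ B ‖) (max _⪰N_ ‖ A ∧ᶠ B ‖)

{-# OPTIONS --safe #-}
module Submission where

-- With all worlds equally normal, the ⪰N-maximal elements of a truth set are all
-- of its worlds, so ○(B/A) says that not every A ∧ B-world is ⪰I-dominated by
-- some A ∧ ¬B-world. Classically, some A ∧ B-world v′ is then dominated by no
-- A ∧ ¬B-world, i.e. every world at least as ideal as v′ satisfies A → B.

open import Defs
open import Level using (_⊔_; 0ℓ) renaming (suc to lsuc)
open import Data.Bool using (true; false)
open import Data.List using (List)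
open import Data.Product using (Σ; ∃; _×_; _,_; proj₁; map₁; map₂)
open import Data.Unit using (tt)
open import Function using (_∘_)
open import Function.Bundles using (_⇔_; mk⇔; Equivalence)
open import Axiom.ExcludedMiddle using (ExcludedMiddle)
open import Relation.Nullary using (¬_; yes; no; contradiction)
open import Relation.Nullary.Decidable using (decidable-stable)
open import Relation.Binary.PropositionalEquality using (refl)

open Equivalence using (to; from)

¬∀⇒∃¬ : ∀ {a p q} {A : Set a} {P : A → Set p} {Q : A → Set q} →
        ExcludedMiddle (a ⊔ p ⊔ q) → ExcludedMiddle q →
        ¬ (∀ x → P x → Q x) → ∃ λ x → P x × ¬ Q x
¬∀⇒∃¬ em emQ ¬∀ with em
... | yes ∃¬ = ∃¬
... | no ∄¬ = contradiction (λ x px → decidable-stable emQ λ ¬qx → ∄¬ (x , px , ¬qx)) ¬∀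

⊨⇒ᶠ⇔⊭∧ᶠ¬ᶠ : ∀ ρ A B → ρ ⊨ (A ⇒ᶠ B) ⇔ (¬ ρ ⊨ (A ∧ᶠ ¬ᶠ B))
⊨⇒ᶠ⇔⊭∧ᶠ¬ᶠ ρ A B with eval ρ A | eval ρ B
... | false | _     = mk⇔ (λ _ ()) (λ _ → refl)
... | true  | true  = mk⇔ (λ _ ()) (λ _ → refl)
... | true  | false = mk⇔ (λ ()) (λ ⊭ → contradiction refl ⊭)

module Properties (Γ : List Fm) (Ro : List Obligation) (M : OrderedModel) where
  open OrderedModel M
  open Semantics Γ Ro M

  ⊆max⪰N : ∀ {X : W → Set} {w} → X w → max _⪰N_ X w
  ⊆max⪰N Xw = Xw , λ _ _ _ → tt

  lift-max⪰N⇔lift : ∀ {ℓ} {_⪰_ : W → W → Set ℓ} {X Y : W → Set} →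
                    lift _⪰_ (max _⪰N_ X) (max _⪰N_ Y) ⇔ lift _⪰_ X Y
  lift-max⪰N⇔lift = mk⇔
    (λ X≽Y y Yy → map₂ (map₁ proj₁) (X≽Y y (⊆max⪰N Yy)))
    (λ X≽Y y (Yy , _) → map₂ (map₁ ⊆max⪰N) (X≽Y y Yy))

  ∄⪰I-∧ᶠ¬ᶠ⇔∀⪰I-⇒ᶠ : ∀ {v′} A B →
                    (¬ Σ W λ u → ‖ A ∧ᶠ ¬ᶠ B ‖ u × u ⪰I v′)
                    ⇔ (∀ u → u ⪰I v′ → ‖ A ⇒ᶠ B ‖ u)
  ∄⪰I-∧ᶠ¬ᶠ⇔∀⪰I-⇒ᶠ A B = mk⇔
    (λ ∄ u u⪰v′ → from (⊨⇒ᶠ⇔⊭∧ᶠ¬ᶠ (v u) A B) λ ⊨A∧¬B → ∄ (u , ⊨A∧¬B , u⪰v′))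
    (λ ∀⊨ (u , ⊨A∧¬B , u⪰v′) → to (⊨⇒ᶠ⇔⊭∧ᶠ¬ᶠ (v u) A B) (∀⊨ u u⪰v′) ⊨A∧¬B)

proposition4 : ExcludedMiddle (lsuc 0ℓ) →
    (Γ : List Fm) (Ro : List Obligation) (M : OrderedModel) →
    let open OrderedModel M in
    let open Semantics Γ Ro M in
    (w : W) (A B : Fm) →
    (w ⊨○[ B / A ])
      ⇔ (Σ W λ v′ → ‖ A ∧ᶠ B ‖ v′ × (∀ u → u ⪰I v′ → ‖ A ⇒ᶠ B ‖ u))
proposition4 em Γ Ro M w A B = mk⇔ ⊨○⇒∃ ∃⇒⊨○
  where
  open OrderedModel M
  open Semantics Γ Ro M
  open Properties Γ Ro M

  ⊨○⇒∃ : w ⊨○[ B / A ] → Σ W λ v′ → ‖ A ∧ᶠ B ‖ v′ × (∀ u → u ⪰I v′ → ‖ A ⇒ᶠ B ‖ u)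
  ⊨○⇒∃ ⊨○ =
    let v′ , ⊨A∧B , ∄ = ¬∀⇒∃¬ em em (⊨○ ∘ from lift-max⪰N⇔lift)
    in  v′ , ⊨A∧B , to (∄⪰I-∧ᶠ¬ᶠ⇔∀⪰I-⇒ᶠ A B) ∄

  ∃⇒⊨○ : (Σ W λ v′ → ‖ A ∧ᶠ B ‖ v′ × (∀ u → u ⪰I v′ → ‖ A ⇒ᶠ B ‖ u)) → w ⊨○[ B / A ]
  ∃⇒⊨○ (v′ , ⊨A∧B , ∀⊨) ≽ =
    from (∄⪰I-∧ᶠ¬ᶠ⇔∀⪰I-⇒ᶠ A B) ∀⊨ (to lift-max⪰N⇔lift ≽ v′ ⊨A∧B)
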